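{- Let $G_1$ and $G_2$ be bipartite graphs with no isolated vertices. For $i=1,2$, order the vertices of $G_i$ so that the vertices of one partite set come first, and write $$A(G_i)=\begin{bmatrix}0 & V_i\\ V_i^T & 0\end{bmatrix},\qquad \mathcal{L}(G_i)=\begin{bmatrix}I & -C_i\\ -C_i^T & I\end{bmatrix}$$ as $2\times 2$ block matrices partitioned conformally with the partite sets. Let $\Gamma$ be the simple graph whose adjacency matrix is $A(G_1)\underline{\otimes}A(G_2)$. Then $$\mathcal{L}(\Gamma)=2I-\big(\mathcal{L}(G_1)\underline{\otimes}\mathcal{L}(G_2)\big).$$
   Context: For a graph $G$ with adjacency matrix $A(G)$ and diagonal degree matrix $D(G)$ (with no isolated vertices), the normalized Laplacian matrix is $\mathcal{L}(G)=I-D(G)^{ -1/2}A(G)D(G)^{ -1/2}$. The partitioned tensor product of two $2\times 2$ block matrices $M=\begin{bmatrix}U & V\\ W & X\end{bmatrix}$ and $N=\begin{bmatrix}A & B\\ C & D\end{bmatrix}$ is $M\underline{\otimes}N=\begin{bmatrix}U\otimes A & V\otimes B\\ W\otimes C & X\otimes D\end{bmatrix}$, where $\otimes$ denotes the Kronecker product. In particular $A(G_1)\underline{\otimes}A(G_2)=\begin{bmatrix}0 & V_1\otimes V_2\\ V_1^T\otimes V_2^T & 0\end{bmatrix}$ is a symmetric $(0,1)$-matrix with zero diagonal, hence the adjacency matrix of a simple bipartite graph. -}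

module Defs where

open import Level using (Level; _⊔_) renaming (suc to lsuc)
open import Data.Nat as ℕ using (ℕ)
open import Data.Bool using (Bool; true; false; if_then_else_)
open import Data.Fin using (Fin; zero; suc; _↑ˡ_; _↑ʳ_; splitAt; remQuot)
open import Data.Fin.Properties using (_≟_)
open import Data.Product using (_×_; _,_; ∃)
open import Data.Sum using (inj₁; inj₂)
open import Relation.Nullary using (¬_; does)
open import Relation.Binary.Structures using (IsTotalOrder)
open import Algebra.Bundles using (CommutativeRing)

Mat : ∀ {a} → Set a → ℕ → ℕ → Set a
Mat X m n = Fin m → Fin n → X

_ᵀ : ∀ {a} {X : Set a} {m n} → Mat X m n → Mat X n m
(M ᵀ) i j = M j i

block : ∀ {a} {X : Set a} {p q} →
        Mat X p p → Mat X p q → Mat X q p → Mat X q q → Mat X (p ℕ.+ q) (p ℕ.+ q)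
block {p = p} U V W Y i j with splitAt p i | splitAt p j
... | inj₁ a | inj₁ b = U a b
... | inj₁ a | inj₂ b = V a b
... | inj₂ a | inj₁ b = W a b
... | inj₂ a | inj₂ b = Y a b

blk11 : ∀ {a} {X : Set a} {p q} → Mat X (p ℕ.+ q) (p ℕ.+ q) → Mat X p p
blk11 {q = q} M i j = M (i ↑ˡ q) (j ↑ˡ q)
blk12 : ∀ {a} {X : Set a} {p q} → Mat X (p ℕ.+ q) (p ℕ.+ q) → Mat X p q
blk12 {p = p} {q} M i j = M (i ↑ˡ q) (p ↑ʳ j)
blk21 : ∀ {a} {X : Set a} {p q} → Mat X (p ℕ.+ q) (p ℕ.+ q) → Mat X q p
blk21 {p = p} {q} M i j = M (p ↑ʳ i) (j ↑ˡ q)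
blk22 : ∀ {a} {X : Set a} {p q} → Mat X (p ℕ.+ q) (p ℕ.+ q) → Mat X q q
blk22 {p = p} M i j = M (p ↑ʳ i) (p ↑ʳ j)

-- Kronecker product w.r.t. a given multiplication of entries
-- (row index i of the product corresponds to the pair (a , b) with i = combine a b)
kron : ∀ {a} {X : Set a} (_·_ : X → X → X) {m m' n n'} →
       Mat X m m' → Mat X n n' → Mat X (m ℕ.* n) (m' ℕ.* n')
kron _·_ {n = n} {n'} M N i j with remQuot n i | remQuot n' j
... | a , b | a' , b' = M a a' · N b b'

ptensor : ∀ {a} {X : Set a} (_·_ : X → X → X) (p1 q1 p2 q2 : ℕ) →
          Mat X (p1 ℕ.+ q1) (p1 ℕ.+ q1) → Mat X (p2 ℕ.+ q2) (p2 ℕ.+ q2) →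
          Mat X (p1 ℕ.* p2 ℕ.+ q1 ℕ.* q2) (p1 ℕ.* p2 ℕ.+ q1 ℕ.* q2)
ptensor _·_ p1 q1 p2 q2 M N =
  block {p = p1 ℕ.* p2} {q = q1 ℕ.* q2}
        (kron _·_ (blk11 {p = p1} {q1} M) (blk11 {p = p2} {q2} N))
        (kron _·_ (blk12 {p = p1} {q1} M) (blk12 {p = p2} {q2} N))
        (kron _·_ (blk21 {p = p1} {q1} M) (blk21 {p = p2} {q2} N))
        (kron _·_ (blk22 {p = p1} {q1} M) (blk22 {p = p2} {q2} N))

sumFin : ∀ {n} → (Fin n → ℕ) → ℕ
sumFin {ℕ.zero}  f = 0
sumFin {ℕ.suc n} f = f zero ℕ.+ sumFin (λ i → f (suc i))

b2n : Bool → ℕ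
b2n true  = 1
b2n false = 0

zeroMat : ∀ {m n} → Mat ℕ m n
zeroMat _ _ = 0

bipAdj : ∀ {p q} → Mat Bool p q → Mat ℕ (p ℕ.+ q) (p ℕ.+ q)
bipAdj V = block zeroMat (λ i j → b2n (V i j)) ((λ i j → b2n (V i j)) ᵀ) zeroMat

NoIsolated : ∀ {p q} → Mat Bool p q → Set
NoIsolated {p} {q} V = (∀ (a : Fin p) → ∃ λ (b : Fin q) → V a b ≡' true)
                     × (∀ (b : Fin q) → ∃ λ (a : Fin p) → V a b ≡' true)
  where open import Relation.Binary.PropositionalEquality renaming (_≡_ to _≡'_)

degree : ∀ {n} → Mat ℕ n n → Fin n → ℕ
degree A i = sumFin (A i)

-- Real scalars: an ordered field in which every nonnegative element has a
-- square root (a Euclidean field; ℝ is one). No real numbers in agda-stdlib.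

record EuclideanField (c ℓ₁ ℓ₂ : Level) : Set (lsuc (c ⊔ ℓ₁ ⊔ ℓ₂)) where
  field
    commutativeRing : CommutativeRing c ℓ₁
  open CommutativeRing commutativeRing public
  field
    _≤_          : Carrier → Carrier → Set ℓ₂
    isTotalOrder : IsTotalOrder _≈_ _≤_
    0≉1          : ¬ (0# ≈ 1#)
    +-mono-≤     : ∀ {x y} z → x ≤ y → (x + z) ≤ (y + z)
    *-nonneg     : ∀ {x y} → 0# ≤ x → 0# ≤ y → 0# ≤ (x * y)
    _⁻¹          : Carrier → Carrier
    inverse      : ∀ x → ¬ (x ≈ 0#) → (x * (x ⁻¹)) ≈ 1#
    sqrt         : Carrier → Carrier
    sqrt-nonneg  : ∀ x → 0# ≤ x → 0# ≤ sqrt x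
    sqrt-square  : ∀ x → 0# ≤ x → (sqrt x * sqrt x) ≈ x

module Spectral {c ℓ₁ ℓ₂} (F : EuclideanField c ℓ₁ ℓ₂) where
  open EuclideanField F

  ι : ℕ → Carrier
  ι ℕ.zero    = 0#
  ι (ℕ.suc n) = 1# + ι n

  I : ∀ {n} → Mat Carrier n n
  I i j = if does (i ≟ j) then 1# else 0#

  invSqrtDeg : ∀ {n} → Mat ℕ n n → Fin n → Carrier
  invSqrtDeg A i = (sqrt (ι (degree A i))) ⁻¹

  normLap : ∀ {n} → Mat ℕ n n → Mat Carrier n n
  normLap A i j = I i j - (invSqrtDeg A i * ι (A i j) * invSqrtDeg A j)

  twoIminus : ∀ {n} → Mat Carrier n n → Mat Carrier n n
  twoIminus M i j = ((I i j + I i j) - M i j)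

  _≋_ : ∀ {m n} → Mat Carrier m n → Mat Carrier m n → Set ℓ₁
  M ≋ N = ∀ i j → M i j ≈ N i j

-- Γ is itself bipartite, with biadjacency matrix V₁ ⊗ V₂, and the vertex (a, b) of Γ has degree
-- deg a · deg b. Since neither graph has isolated vertices these degrees are nonzero, so
-- 1/√(deg a · deg b) = (1/√deg a)(1/√deg b) and the off-diagonal block of 𝓛(Γ) is −C₁ ⊗ C₂, where
-- 𝓛(Gᵢ) = [I, −Cᵢ; −Cᵢᵀ, I]. On the other side (−C₁) ⊗ (−C₂) = C₁ ⊗ C₂ and I ⊗ I = I, so
-- 2I − 𝓛(G₁) ⊗̲ 𝓛(G₂) has the same four blocks.
module Submission where

open import Defs
open import Level using (Level)
open import Data.Nat using (ℕ; _*_; zero; suc; NonZero; >-nonZero)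
open import Data.Bool using (Bool; true; false; _∧_; if_then_else_)
import Data.Nat as ℕ
import Data.Nat.Properties as ℕₚ
import Data.Fin as Fin
open import Data.Fin using (Fin; _↑ˡ_; _↑ʳ_; splitAt; join; remQuot; combine)
open import Data.Fin.Properties
  using (_≟_; splitAt-↑ˡ; splitAt-↑ʳ; join-splitAt; ↑ˡ-injective; ↑ʳ-injective;
         remQuot-combine; combine-remQuot; combine-injectiveˡ; combine-injectiveʳ)
open import Data.Product using (_,_; proj₁; proj₂)
open import Data.Sum using (inj₁; inj₂)
open import Relation.Nullary using (¬_; Dec; yes; no)
open import Relation.Nullary.Decidable using (dec-true; dec-false)
open import Function using (_∘_)
open import Relation.Binary.Structures using (IsTotalOrder)
open import Relation.Binary.PropositionalEquality as ≡ using (_≡_; _≢_; refl; cong; cong₂)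

↑-ind : ∀ {ℓ} {p q} (R : Fin (p ℕ.+ q) → Set ℓ) →
        (∀ x → R (x ↑ˡ q)) → (∀ y → R (p ↑ʳ y)) → ∀ i → R i
↑-ind {p = p} {q} R left right i = ≡.subst R (join-splitAt p q i) (on-split (splitAt p i))
  where
  on-split : ∀ s → R (join p q s)
  on-split (inj₁ x) = left x
  on-split (inj₂ y) = right y

combine-ind : ∀ {ℓ} {m n} (R : Fin (m * n) → Set ℓ) → (∀ a b → R (combine a b)) → ∀ i → R i
combine-ind {m = m} {n} R f i =
  ≡.subst R (combine-remQuot {m} n i) (f (proj₁ (remQuot {m} n i)) (proj₂ (remQuot {m} n i)))

tensor-ind : ∀ {ℓ} {p₁ q₁ p₂ q₂} (R : Fin (p₁ * p₂ ℕ.+ q₁ * q₂) → Set ℓ) →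
             (∀ (a : Fin p₁) (b : Fin p₂) → R (combine a b ↑ˡ q₁ * q₂)) →
             (∀ (a : Fin q₁) (b : Fin q₂) → R (p₁ * p₂ ↑ʳ combine a b)) →
             ∀ i → R i
tensor-ind {p₁ = p₁} {q₁} {p₂} {q₂} R left right =
  ↑-ind R (combine-ind (λ x → R (x ↑ˡ q₁ * q₂)) left) (combine-ind (λ y → R (p₁ * p₂ ↑ʳ y)) right)

tensor-ind₂ : ∀ {ℓ} {p₁ q₁ p₂ q₂}
  (R : Fin (p₁ * p₂ ℕ.+ q₁ * q₂) → Fin (p₁ * p₂ ℕ.+ q₁ * q₂) → Set ℓ) →
  (∀ (a : Fin p₁) (b : Fin p₂) (a' : Fin p₁) (b' : Fin p₂) →
     R (combine a b ↑ˡ q₁ * q₂) (combine a' b' ↑ˡ q₁ * q₂)) →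
  (∀ (a : Fin p₁) (b : Fin p₂) (a' : Fin q₁) (b' : Fin q₂) →
     R (combine a b ↑ˡ q₁ * q₂) (p₁ * p₂ ↑ʳ combine a' b')) →
  (∀ (a : Fin q₁) (b : Fin q₂) (a' : Fin p₁) (b' : Fin p₂) →
     R (p₁ * p₂ ↑ʳ combine a b) (combine a' b' ↑ˡ q₁ * q₂)) →
  (∀ (a : Fin q₁) (b : Fin q₂) (a' : Fin q₁) (b' : Fin q₂) →
     R (p₁ * p₂ ↑ʳ combine a b) (p₁ * p₂ ↑ʳ combine a' b')) →
  ∀ i j → R i j
tensor-ind₂ {p₁ = p₁} {q₁} {p₂} {q₂} R ll lr rl rr =
  tensor-ind (λ i → ∀ j → R i j)
    (λ a b → tensor-ind (R (combine a b ↑ˡ q₁ * q₂)) (ll a b) (lr a b))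
    (λ a b → tensor-ind (R (p₁ * p₂ ↑ʳ combine a b)) (rl a b) (rr a b))

module _ {a} {X : Set a} {p q : ℕ}
         (U : Mat X p p) (V : Mat X p q) (W : Mat X q p) (Y : Mat X q q) where

  block-↑ˡ↑ˡ : ∀ x y → block U V W Y (x ↑ˡ q) (y ↑ˡ q) ≡ U x y
  block-↑ˡ↑ˡ x y rewrite splitAt-↑ˡ p x q | splitAt-↑ˡ p y q = refl

  block-↑ˡ↑ʳ : ∀ x y → block U V W Y (x ↑ˡ q) (p ↑ʳ y) ≡ V x y
  block-↑ˡ↑ʳ x y rewrite splitAt-↑ˡ p x q | splitAt-↑ʳ p q y = refl

  block-↑ʳ↑ˡ : ∀ x y → block U V W Y (p ↑ʳ x) (y ↑ˡ q) ≡ W x y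
  block-↑ʳ↑ˡ x y rewrite splitAt-↑ʳ p q x | splitAt-↑ˡ p y q = refl

  block-↑ʳ↑ʳ : ∀ x y → block U V W Y (p ↑ʳ x) (p ↑ʳ y) ≡ Y x y
  block-↑ʳ↑ʳ x y rewrite splitAt-↑ʳ p q x | splitAt-↑ʳ p q y = refl

↑ˡ≢↑ʳ : ∀ {p q} (x : Fin p) (y : Fin q) → x ↑ˡ q ≢ p ↑ʳ y
↑ˡ≢↑ʳ {p} {q} x y x↑ˡq≡p↑ʳy
  with ≡.trans (≡.sym (splitAt-↑ˡ p x q)) (≡.trans (cong (splitAt p) x↑ˡq≡p↑ʳy) (splitAt-↑ʳ p q y))
... | ()

kron-combine : ∀ {a} {X : Set a} (_·_ : X → X → X) {m m' n n'}
               (M : Mat X m m') (N : Mat X n n') a b a' b' →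
               kron _·_ M N (combine a b) (combine a' b') ≡ M a a' · N b b'
kron-combine _·_ {n = n} {n'} M N a b a' b' =
  cong₂ (λ r r' → M (proj₁ r) (proj₁ r') · N (proj₂ r) (proj₂ r'))
        (remQuot-combine {k = n} a b) (remQuot-combine {k = n'} a' b')

module _ {a} {X : Set a} (_·_ : X → X → X) {p₁ q₁ p₂ q₂ : ℕ}
         (M : Mat X (p₁ ℕ.+ q₁) (p₁ ℕ.+ q₁)) (N : Mat X (p₂ ℕ.+ q₂) (p₂ ℕ.+ q₂)) where
  private
    T = ptensor _·_ p₁ q₁ p₂ q₂ M N
    M₁₁ = blk11 {p = p₁} {q₁} M; M₁₂ = blk12 {p = p₁} {q₁} M
    M₂₁ = blk21 {p = p₁} {q₁} M; M₂₂ = blk22 {p = p₁} {q₁} M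
    N₁₁ = blk11 {p = p₂} {q₂} N; N₁₂ = blk12 {p = p₂} {q₂} N
    N₂₁ = blk21 {p = p₂} {q₂} N; N₂₂ = blk22 {p = p₂} {q₂} N
    K₁₁ = kron _·_ M₁₁ N₁₁; K₁₂ = kron _·_ M₁₂ N₁₂
    K₂₁ = kron _·_ M₂₁ N₂₁; K₂₂ = kron _·_ M₂₂ N₂₂

  ptensor-↑ˡ↑ˡ : ∀ a b a' b' → T (combine a b ↑ˡ q₁ * q₂) (combine a' b' ↑ˡ q₁ * q₂)
                              ≡ M (a ↑ˡ q₁) (a' ↑ˡ q₁) · N (b ↑ˡ q₂) (b' ↑ˡ q₂)
  ptensor-↑ˡ↑ˡ a b a' b' =
    ≡.trans (block-↑ˡ↑ˡ K₁₁ K₁₂ K₂₁ K₂₂ _ _) (kron-combine _·_ M₁₁ N₁₁ a b a' b')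

  ptensor-↑ˡ↑ʳ : ∀ a b a' b' → T (combine a b ↑ˡ q₁ * q₂) (p₁ * p₂ ↑ʳ combine a' b')
                              ≡ M (a ↑ˡ q₁) (p₁ ↑ʳ a') · N (b ↑ˡ q₂) (p₂ ↑ʳ b')
  ptensor-↑ˡ↑ʳ a b a' b' =
    ≡.trans (block-↑ˡ↑ʳ K₁₁ K₁₂ K₂₁ K₂₂ _ _) (kron-combine _·_ M₁₂ N₁₂ a b a' b')

  ptensor-↑ʳ↑ˡ : ∀ a b a' b' → T (p₁ * p₂ ↑ʳ combine a b) (combine a' b' ↑ˡ q₁ * q₂)
                              ≡ M (p₁ ↑ʳ a) (a' ↑ˡ q₁) · N (p₂ ↑ʳ b) (b' ↑ˡ q₂)
  ptensor-↑ʳ↑ˡ a b a' b' =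
    ≡.trans (block-↑ʳ↑ˡ K₁₁ K₁₂ K₂₁ K₂₂ _ _) (kron-combine _·_ M₂₁ N₂₁ a b a' b')

  ptensor-↑ʳ↑ʳ : ∀ a b a' b' → T (p₁ * p₂ ↑ʳ combine a b) (p₁ * p₂ ↑ʳ combine a' b')
                              ≡ M (p₁ ↑ʳ a) (p₁ ↑ʳ a') · N (p₂ ↑ʳ b) (p₂ ↑ʳ b')
  ptensor-↑ʳ↑ʳ a b a' b' =
    ≡.trans (block-↑ʳ↑ʳ K₁₁ K₁₂ K₂₁ K₂₂ _ _) (kron-combine _·_ M₂₂ N₂₂ a b a' b')

sumFin-cong : ∀ {n} {f g : Fin n → ℕ} → (∀ i → f i ≡ g i) → sumFin f ≡ sumFin g
sumFin-cong {zero}  f≗g = refl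
sumFin-cong {suc n} f≗g = cong₂ ℕ._+_ (f≗g Fin.zero) (sumFin-cong (λ i → f≗g (Fin.suc i)))

sumFin-zero : ∀ {n} → sumFin {n} (λ _ → 0) ≡ 0
sumFin-zero {zero}  = refl
sumFin-zero {suc n} = sumFin-zero {n}

sumFin-↑ : ∀ {p q} (f : Fin (p ℕ.+ q) → ℕ) →
           sumFin f ≡ sumFin {p} (λ x → f (x ↑ˡ q)) ℕ.+ sumFin {q} (λ y → f (p ↑ʳ y))
sumFin-↑ {zero}      f = refl
sumFin-↑ {suc p} {q} f =
  ≡.trans (cong (f Fin.zero ℕ.+_) (sumFin-↑ {p} {q} (λ i → f (Fin.suc i))))
          (≡.sym (ℕₚ.+-assoc (f Fin.zero) _ _))

sumFin-combine : ∀ {m n} (f : Fin (m * n) → ℕ) →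
                 sumFin f ≡ sumFin {m} (λ a → sumFin {n} (λ b → f (combine a b)))
sumFin-combine {zero}      f = refl
sumFin-combine {suc m} {n} f =
  ≡.trans (sumFin-↑ {n} {m * n} f)
          (cong (sumFin {n} (λ b → f (b ↑ˡ m * n)) ℕ.+_) (sumFin-combine {m} (λ i → f (n ↑ʳ i))))

sumFin-*ˡ : ∀ {n} c (f : Fin n → ℕ) → sumFin (λ i → c * f i) ≡ c * sumFin f
sumFin-*ˡ {zero}  c f = ≡.sym (ℕₚ.*-zeroʳ c)
sumFin-*ˡ {suc n} c f =
  ≡.trans (cong (c * f Fin.zero ℕ.+_) (sumFin-*ˡ c (λ i → f (Fin.suc i))))
          (≡.sym (ℕₚ.*-distribˡ-+ c (f Fin.zero) _))

sumFin-separable : ∀ {m n} {h : Fin (m * n) → ℕ} (f : Fin m → ℕ) (g : Fin n → ℕ) →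
                   (∀ a b → h (combine a b) ≡ f a * g b) → sumFin h ≡ sumFin f * sumFin g
sumFin-separable {m} {n} {h} f g h≗f⊗g = begin
  sumFin h                                            ≡⟨ sumFin-combine {m} h ⟩
  sumFin (λ a → sumFin (λ b → h (combine {m} {n} a b))) ≡⟨ sumFin-cong (sumFin-cong ∘ h≗f⊗g) ⟩
  sumFin (λ a → sumFin (λ b → f a * g b))             ≡⟨ sumFin-cong (λ a → sumFin-*ˡ (f a) g) ⟩
  sumFin (λ a → f a * sumFin g)                       ≡⟨ sumFin-cong (λ a → ℕₚ.*-comm (f a) _) ⟩
  sumFin (λ a → sumFin g * f a)                       ≡⟨ sumFin-*ˡ (sumFin g) f ⟩
  sumFin g * sumFin f                                 ≡⟨ ℕₚ.*-comm (sumFin g) _ ⟩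
  sumFin f * sumFin g                                 ∎
  where open ≡.≡-Reasoning

≤-sumFin : ∀ {n} (f : Fin n → ℕ) i → f i ℕ.≤ sumFin f
≤-sumFin f Fin.zero    = ℕₚ.m≤m+n _ _
≤-sumFin f (Fin.suc i) = ℕₚ.≤-trans (≤-sumFin (λ j → f (Fin.suc j)) i) (ℕₚ.m≤n+m _ (f Fin.zero))

b2n-∧ : ∀ x y → b2n (x ∧ y) ≡ b2n x * b2n y
b2n-∧ true  y = ≡.sym (ℕₚ.+-identityʳ (b2n y))
b2n-∧ false y = refl

rowDeg : ∀ {p q} → Mat Bool p q → Fin p → ℕ
rowDeg V x = sumFin (λ y → b2n (V x y))

colDeg : ∀ {p q} → Mat Bool p q → Fin q → ℕ
colDeg V = rowDeg (V ᵀ)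

module _ {p q} (V : Mat Bool p q) where
  private
    B : Mat ℕ p q
    B x y = b2n (V x y)

  bipAdj-↑ˡ↑ˡ : ∀ x y → bipAdj V (x ↑ˡ q) (y ↑ˡ q) ≡ 0
  bipAdj-↑ˡ↑ˡ = block-↑ˡ↑ˡ zeroMat B (B ᵀ) zeroMat

  bipAdj-↑ˡ↑ʳ : ∀ x y → bipAdj V (x ↑ˡ q) (p ↑ʳ y) ≡ b2n (V x y)
  bipAdj-↑ˡ↑ʳ = block-↑ˡ↑ʳ zeroMat B (B ᵀ) zeroMat

  bipAdj-↑ʳ↑ˡ : ∀ y x → bipAdj V (p ↑ʳ y) (x ↑ˡ q) ≡ b2n (V x y)
  bipAdj-↑ʳ↑ˡ = block-↑ʳ↑ˡ zeroMat B (B ᵀ) zeroMat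

  bipAdj-↑ʳ↑ʳ : ∀ x y → bipAdj V (p ↑ʳ x) (p ↑ʳ y) ≡ 0
  bipAdj-↑ʳ↑ʳ = block-↑ʳ↑ʳ zeroMat B (B ᵀ) zeroMat

  degree-bipAdj-↑ˡ : ∀ x → degree (bipAdj V) (x ↑ˡ q) ≡ rowDeg V x
  degree-bipAdj-↑ˡ x = ≡.trans (sumFin-↑ {p} (bipAdj V (x ↑ˡ q)))
    (cong₂ ℕ._+_ (≡.trans (sumFin-cong (bipAdj-↑ˡ↑ˡ x)) (sumFin-zero {p}))
                 (sumFin-cong (bipAdj-↑ˡ↑ʳ x)))

  degree-bipAdj-↑ʳ : ∀ y → degree (bipAdj V) (p ↑ʳ y) ≡ colDeg V y
  degree-bipAdj-↑ʳ y = ≡.trans (sumFin-↑ {p} (bipAdj V (p ↑ʳ y)))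
    (≡.trans (cong₂ ℕ._+_ (sumFin-cong (bipAdj-↑ʳ↑ˡ y))
                          (≡.trans (sumFin-cong (bipAdj-↑ʳ↑ʳ y)) (sumFin-zero {q})))
             (ℕₚ.+-identityʳ _))

  rowDeg-nonZero : NoIsolated V → ∀ x → NonZero (rowDeg V x)
  rowDeg-nonZero (noIsolatedRow , _) x with noIsolatedRow x
  ... | y , Vxy≡true = >-nonZero (≡.subst (ℕ._≤ rowDeg V x) (cong b2n Vxy≡true) (≤-sumFin _ y))

  colDeg-nonZero : NoIsolated V → ∀ y → NonZero (colDeg V y)
  colDeg-nonZero (_ , noIsolatedCol) y with noIsolatedCol y
  ... | x , Vxy≡true = >-nonZero (≡.subst (ℕ._≤ colDeg V y) (cong b2n Vxy≡true) (≤-sumFin _ x))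

module _ {p₁ q₁ p₂ q₂} (V₁ : Mat Bool p₁ q₁) (V₂ : Mat Bool p₂ q₂) where
  private
    W = kron _∧_ V₁ V₂

  b2n-kron : ∀ a b a' b' → b2n (W (combine a b) (combine a' b')) ≡ b2n (V₁ a a') * b2n (V₂ b b')
  b2n-kron a b a' b' = ≡.trans (cong b2n (kron-combine _∧_ V₁ V₂ a b a' b')) (b2n-∧ (V₁ a a') _)

  rowDeg-kron : ∀ a b → rowDeg W (combine a b) ≡ rowDeg V₁ a * rowDeg V₂ b
  rowDeg-kron a b = sumFin-separable _ _ (b2n-kron a b)

  colDeg-kron : ∀ a b → colDeg W (combine a b) ≡ colDeg V₁ a * colDeg V₂ b
  colDeg-kron a b = sumFin-separable _ _ (λ a' b' → b2n-kron a' b' a b)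

  ptensor-bipAdj : ∀ i j → ptensor _*_ p₁ q₁ p₂ q₂ (bipAdj V₁) (bipAdj V₂) i j ≡ bipAdj W i j
  ptensor-bipAdj = tensor-ind₂ _
    (λ a b a' b' → ≡.trans (ptensor-↑ˡ↑ˡ _*_ (bipAdj V₁) (bipAdj V₂) a b a' b')
      (≡.trans (cong₂ _*_ (bipAdj-↑ˡ↑ˡ V₁ a a') (bipAdj-↑ˡ↑ˡ V₂ b b')) (≡.sym (bipAdj-↑ˡ↑ˡ W _ _))))
    (λ a b a' b' → ≡.trans (ptensor-↑ˡ↑ʳ _*_ (bipAdj V₁) (bipAdj V₂) a b a' b')
      (≡.trans (cong₂ _*_ (bipAdj-↑ˡ↑ʳ V₁ a a') (bipAdj-↑ˡ↑ʳ V₂ b b'))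
        (≡.trans (≡.sym (b2n-kron a b a' b')) (≡.sym (bipAdj-↑ˡ↑ʳ W _ _)))))
    (λ a b a' b' → ≡.trans (ptensor-↑ʳ↑ˡ _*_ (bipAdj V₁) (bipAdj V₂) a b a' b')
      (≡.trans (cong₂ _*_ (bipAdj-↑ʳ↑ˡ V₁ a a') (bipAdj-↑ʳ↑ˡ V₂ b b'))
        (≡.trans (≡.sym (b2n-kron a' b' a b)) (≡.sym (bipAdj-↑ʳ↑ˡ W _ _)))))
    (λ a b a' b' → ≡.trans (ptensor-↑ʳ↑ʳ _*_ (bipAdj V₁) (bipAdj V₂) a b a' b')
      (≡.trans (cong₂ _*_ (bipAdj-↑ʳ↑ʳ V₁ a a') (bipAdj-↑ʳ↑ʳ V₂ b b')) (≡.sym (bipAdj-↑ʳ↑ʳ W _ _))))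

module _ {c ℓ₁ ℓ₂} (F : EuclideanField c ℓ₁ ℓ₂) where
  open EuclideanField F renaming (_*_ to _·_) hiding (zero; refl)
  open Spectral F
  open import Algebra.Properties.Ring ring using (-‿distribˡ-*; -‿distribʳ-*)
  open import Algebra.Properties.Group +-group using (⁻¹-involutive; ε⁻¹≈ε)
  open import Algebra.Properties.CommutativeSemigroup *-commutativeSemigroup
    using (interchange; xy∙z≈zy∙x)
  open import Relation.Binary.Reasoning.Setoid setoid
  private module ≤ = IsTotalOrder isTotalOrder

  -x·-y≈x·y : ∀ x y → (- x) · (- y) ≈ x · y
  -x·-y≈x·y x y = begin
    (- x) · (- y)  ≈⟨ -‿distribˡ-* x (- y) ⟨
    - (x · - y)    ≈⟨ -‿cong (-‿distribʳ-* x y) ⟨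
    - - (x · y)    ≈⟨ ⁻¹-involutive (x · y) ⟩
    x · y          ∎

  0≤1 : 0# ≤ 1#
  0≤1 with ≤.total 0# 1#
  ... | inj₁ 0≤1 = 0≤1
  ... | inj₂ 1≤0 = ≤.≲-respʳ-≈ (trans (-x·-y≈x·y 1# 1#) (*-identityˡ 1#)) (*-nonneg 0≤-1 0≤-1)
    where
    0≤-1 : 0# ≤ (- 1#)
    0≤-1 = ≤.≲-respˡ-≈ (-‿inverseʳ 1#) (≤.≲-respʳ-≈ (+-identityˡ (- 1#)) (+-mono-≤ (- 1#) 1≤0))

  ι-+ : ∀ m n → ι (m ℕ.+ n) ≈ ι m + ι n
  ι-+ zero    n = sym (+-identityˡ (ι n))
  ι-+ (suc m) n = trans (+-congˡ (ι-+ m n)) (sym (+-assoc 1# (ι m) (ι n)))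

  ι-* : ∀ m n → ι (m * n) ≈ ι m · ι n
  ι-* zero    n = sym (zeroˡ (ι n))
  ι-* (suc m) n = begin
    ι (n ℕ.+ m * n)       ≈⟨ ι-+ n (m * n) ⟩
    ι n + ι (m * n)       ≈⟨ +-cong (sym (*-identityˡ (ι n))) (ι-* m n) ⟩
    1# · ι n + ι m · ι n  ≈⟨ distribʳ (ι n) 1# (ι m) ⟨
    (1# + ι m) · ι n      ∎

  ι-nonneg : ∀ n → 0# ≤ ι n
  ι-nonneg zero    = ≤.refl
  ι-nonneg (suc n) = ≤.trans (ι-nonneg n) (≤.≲-respˡ-≈ (+-identityˡ (ι n)) (+-mono-≤ (ι n) 0≤1))

  ι≉0 : ∀ n .{{_ : NonZero n}} → ¬ ι n ≈ 0#
  ι≉0 (suc n) 1+n≈0 = 0≉1 (≤.antisym 0≤1 1≤0)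
    where
    1≤0 : 1# ≤ 0#
    1≤0 = ≤.≲-respˡ-≈ (+-identityˡ 1#) (≤.≲-respʳ-≈ (trans (+-comm (ι n) 1#) 1+n≈0)
                                                    (+-mono-≤ 1# (ι-nonneg n)))

  *-cancelʳ : ∀ {s a b} → ¬ s ≈ 0# → a · s ≈ b · s → a ≈ b
  *-cancelʳ {s} {a} {b} s≉0 as≈bs = begin
    a                ≈⟨ *-identityʳ a ⟨
    a · 1#           ≈⟨ *-congˡ (inverse s s≉0) ⟨
    a · (s · s ⁻¹)   ≈⟨ *-assoc a s (s ⁻¹) ⟨
    (a · s) · s ⁻¹   ≈⟨ *-congʳ as≈bs ⟩
    (b · s) · s ⁻¹   ≈⟨ *-assoc b s (s ⁻¹) ⟩
    b · (s · s ⁻¹)   ≈⟨ *-congˡ (inverse s s≉0) ⟩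
    b · 1#           ≈⟨ *-identityʳ b ⟩
    b                ∎

  inverse-unique : ∀ {a u v} → a · u ≈ 1# → a · v ≈ 1# → u ≈ v
  inverse-unique {a} {u} {v} au≈1 av≈1 = begin
    u            ≈⟨ *-identityʳ u ⟨
    u · 1#       ≈⟨ *-congˡ av≈1 ⟨
    u · (a · v)  ≈⟨ *-assoc u a v ⟨
    (u · a) · v  ≈⟨ *-congʳ (trans (*-comm u a) au≈1) ⟩
    1# · v       ≈⟨ *-identityˡ v ⟩
    v            ∎

  -- a² = b² gives a(a + b) = b(a + b), and a + b ≉ 0 because a, b ≥ 0 and b ≉ 0.
  sqrt-unique : ∀ {a b} → 0# ≤ a → 0# ≤ b → a · a ≈ b · b → ¬ b · b ≈ 0# → a ≈ b
  sqrt-unique {a} {b} 0≤a 0≤b aa≈bb bb≉0 = *-cancelʳ a+b≉0 (begin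
    a · (a + b)    ≈⟨ distribˡ a a b ⟩
    a · a + a · b  ≈⟨ +-cong aa≈bb (*-comm a b) ⟩
    b · b + b · a  ≈⟨ +-comm (b · b) (b · a) ⟩
    b · a + b · b  ≈⟨ distribˡ b a b ⟨
    b · (a + b)    ∎)
    where
    a+b≉0 : ¬ a + b ≈ 0#
    a+b≉0 a+b≈0 = bb≉0 (trans (*-congʳ b≈0) (zeroˡ b))
      where
      b≈0 : b ≈ 0#
      b≈0 = ≤.antisym (≤.≲-respˡ-≈ (+-identityˡ b) (≤.≲-respʳ-≈ a+b≈0 (+-mono-≤ b 0≤a))) 0≤b

  sqrt-* : ∀ {x y z} → 0# ≤ x → 0# ≤ y → ¬ z ≈ 0# → z ≈ x · y → sqrt z ≈ sqrt x · sqrt y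
  sqrt-* {x} {y} {z} 0≤x 0≤y z≉0 z≈xy =
    sqrt-unique (sqrt-nonneg z 0≤z) (*-nonneg (sqrt-nonneg x 0≤x) (sqrt-nonneg y 0≤y))
                squares≈ (λ e → z≉0 (trans (sym (sqrt-square z 0≤z)) (trans squares≈ e)))
    where
    0≤z : 0# ≤ z
    0≤z = ≤.≲-respʳ-≈ (sym z≈xy) (*-nonneg 0≤x 0≤y)
    squares≈ : sqrt z · sqrt z ≈ (sqrt x · sqrt y) · (sqrt x · sqrt y)
    squares≈ = begin
      sqrt z · sqrt z                        ≈⟨ sqrt-square z 0≤z ⟩
      z                                      ≈⟨ z≈xy ⟩
      x · y                                  ≈⟨ *-cong (sqrt-square x 0≤x) (sqrt-square y 0≤y) ⟨
      (sqrt x · sqrt x) · (sqrt y · sqrt y)  ≈⟨ interchange (sqrt x) (sqrt x) (sqrt y) (sqrt y) ⟩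
      (sqrt x · sqrt y) · (sqrt x · sqrt y)  ∎

  ⁻¹-* : ∀ {a b c} → ¬ a ≈ 0# → ¬ b ≈ 0# → c ≈ a · b → c ⁻¹ ≈ a ⁻¹ · b ⁻¹
  ⁻¹-* {a} {b} {c} a≉0 b≉0 c≈ab = inverse-unique (inverse c c≉0) c·a⁻¹b⁻¹≈1
    where
    c·a⁻¹b⁻¹≈1 : c · (a ⁻¹ · b ⁻¹) ≈ 1#
    c·a⁻¹b⁻¹≈1 = begin
      c · (a ⁻¹ · b ⁻¹)          ≈⟨ *-congʳ c≈ab ⟩
      (a · b) · (a ⁻¹ · b ⁻¹)    ≈⟨ interchange a b (a ⁻¹) (b ⁻¹) ⟩
      (a · a ⁻¹) · (b · b ⁻¹)    ≈⟨ *-cong (inverse a a≉0) (inverse b b≉0) ⟩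
      1# · 1#                    ≈⟨ *-identityˡ 1# ⟩
      1#                         ∎
    c≉0 : ¬ c ≈ 0#
    c≉0 c≈0 = 0≉1 (trans (sym (zeroˡ _)) (trans (*-congʳ (sym c≈0)) c·a⁻¹b⁻¹≈1))

  invSqrt : ℕ → Carrier
  invSqrt n = sqrt (ι n) ⁻¹

  sqrt-ι≉0 : ∀ n .{{_ : NonZero n}} → ¬ sqrt (ι n) ≈ 0#
  sqrt-ι≉0 n s≈0 =
    ι≉0 n (trans (sym (sqrt-square (ι n) (ι-nonneg n))) (trans (*-congʳ s≈0) (zeroˡ _)))

  invSqrt-* : ∀ m n .{{_ : NonZero m}} .{{_ : NonZero n}} → invSqrt (m * n) ≈ invSqrt m · invSqrt n
  invSqrt-* m n = ⁻¹-* (sqrt-ι≉0 m) (sqrt-ι≉0 n)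
    (sqrt-* (ι-nonneg m) (ι-nonneg n) (ι≉0 (m * n) {{ℕₚ.m*n≢0 m n}}) (ι-* m n))

  I-≡ : ∀ {n} {x y : Fin n} → x ≡ y → I x y ≡ 1#
  I-≡ {x = x} {y} x≡y = cong (λ b → if b then 1# else 0#) (dec-true (x ≟ y) x≡y)

  I-≢ : ∀ {n} {x y : Fin n} → x ≢ y → I x y ≡ 0#
  I-≢ {x = x} {y} x≢y = cong (λ b → if b then 1# else 0#) (dec-false (x ≟ y) x≢y)

  I-injective : ∀ {m n} {f : Fin m → Fin n} → (∀ {x y} → f x ≡ f y → x ≡ y) →
                ∀ x y → I (f x) (f y) ≡ I x y
  I-injective {f = f} f-injective x y = by-cases (x ≟ y)
    where
    by-cases : Dec (x ≡ y) → I (f x) (f y) ≡ I x y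
    by-cases (yes x≡y) = ≡.trans (I-≡ (cong f x≡y)) (≡.sym (I-≡ x≡y))
    by-cases (no x≢y)  = ≡.trans (I-≢ (x≢y ∘ f-injective)) (≡.sym (I-≢ x≢y))

  I-↑ˡ↑ˡ : ∀ {p q} (x y : Fin p) → I (x ↑ˡ q) (y ↑ˡ q) ≡ I x y
  I-↑ˡ↑ˡ {q = q} = I-injective (↑ˡ-injective q _ _)

  I-↑ʳ↑ʳ : ∀ {p q} (x y : Fin q) → I (p ↑ʳ x) (p ↑ʳ y) ≡ I x y
  I-↑ʳ↑ʳ {p} = I-injective (↑ʳ-injective p _ _)

  I-↑ˡ↑ʳ : ∀ {p q} (x : Fin p) (y : Fin q) → I (x ↑ˡ q) (p ↑ʳ y) ≡ 0#
  I-↑ˡ↑ʳ x y = I-≢ (↑ˡ≢↑ʳ x y)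

  I-↑ʳ↑ˡ : ∀ {p q} (y : Fin q) (x : Fin p) → I (p ↑ʳ y) (x ↑ˡ q) ≡ 0#
  I-↑ʳ↑ˡ y x = I-≢ (↑ˡ≢↑ʳ x y ∘ ≡.sym)

  I-combine : ∀ {m n} (a : Fin m) (b : Fin n) a' b' →
              I (combine a b) (combine a' b') ≈ I a a' · I b b'
  I-combine a b a' b' = by-cases (a ≟ a') (b ≟ b')
    where
    by-cases : Dec (a ≡ a') → Dec (b ≡ b') → I (combine a b) (combine a' b') ≈ I a a' · I b b'
    by-cases (yes a≡a') (yes b≡b') = begin
      I (combine a b) (combine a' b')  ≡⟨ I-≡ (cong₂ combine a≡a' b≡b') ⟩
      1#                               ≈⟨ *-identityˡ 1# ⟨
      1# · 1#                          ≡⟨ cong₂ _·_ (I-≡ a≡a') (I-≡ b≡b') ⟨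
      I a a' · I b b'                  ∎
    by-cases (no a≢a') _ = begin
      I (combine a b) (combine a' b')  ≡⟨ I-≢ (a≢a' ∘ combine-injectiveˡ a b a' b') ⟩
      0#                               ≈⟨ zeroˡ (I b b') ⟨
      0# · I b b'                      ≡⟨ cong (_· I b b') (I-≢ a≢a') ⟨
      I a a' · I b b'                  ∎
    by-cases (yes _) (no b≢b') = begin
      I (combine a b) (combine a' b')  ≡⟨ I-≢ (b≢b' ∘ combine-injectiveʳ a b a' b') ⟩
      0#                               ≈⟨ zeroʳ (I a a') ⟨
      I a a' · 0#                      ≡⟨ cong (I a a' ·_) (I-≢ b≢b') ⟨
      I a a' · I b b'                  ∎

  normLap-cong : ∀ {n} {A B : Mat ℕ n n} → (∀ i j → A i j ≡ B i j) →
                 ∀ i j → normLap A i j ≡ normLap B i j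
  normLap-cong {A = A} {B} A≗B i j = cong (λ x → I i j - x)
    (cong₂ _·_ (cong₂ _·_ (invSqrtDeg-cong i) (cong ι (A≗B i j))) (invSqrtDeg-cong j))
    where
    invSqrtDeg-cong : ∀ k → invSqrtDeg A k ≡ invSqrtDeg B k
    invSqrtDeg-cong k = cong invSqrt (sumFin-cong (A≗B k))

  x-y·0·z≈x : ∀ x y z → x - y · 0# · z ≈ x
  x-y·0·z≈x x y z = begin
    x - y · 0# · z  ≈⟨ +-congˡ (-‿cong (trans (*-congʳ (zeroʳ y)) (zeroˡ z))) ⟩
    x - 0#          ≈⟨ +-congˡ ε⁻¹≈ε ⟩
    x + 0#          ≈⟨ +-identityʳ x ⟩
    x               ∎

  -- The block C = D₁^{-1/2} V D₂^{-1/2} of 𝓛(bipAdj V) = [I, −C; −Cᵀ, I].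
  normBiadj : ∀ {p q} → Mat Bool p q → Mat Carrier p q
  normBiadj V x y = invSqrt (rowDeg V x) · ι (b2n (V x y)) · invSqrt (colDeg V y)

  module _ {p q} (V : Mat Bool p q) where
    private
      A = bipAdj V

    normLap-bipAdj-↑ˡ↑ˡ : ∀ x y → normLap (bipAdj V) (x ↑ˡ q) (y ↑ˡ q) ≈ I x y
    normLap-bipAdj-↑ˡ↑ˡ x y = trans
      (reflexive (cong₂ (λ δ e → δ - invSqrtDeg A (x ↑ˡ q) · ι e · invSqrtDeg A (y ↑ˡ q))
                        (I-↑ˡ↑ˡ {q = q} x y) (bipAdj-↑ˡ↑ˡ V x y)))
      (x-y·0·z≈x _ _ _)

    normLap-bipAdj-↑ʳ↑ʳ : ∀ x y → normLap (bipAdj V) (p ↑ʳ x) (p ↑ʳ y) ≈ I x y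
    normLap-bipAdj-↑ʳ↑ʳ x y = trans
      (reflexive (cong₂ (λ δ e → δ - invSqrtDeg A (p ↑ʳ x) · ι e · invSqrtDeg A (p ↑ʳ y))
                        (I-↑ʳ↑ʳ {p} x y) (bipAdj-↑ʳ↑ʳ V x y)))
      (x-y·0·z≈x _ _ _)

    normLap-bipAdj-↑ˡ↑ʳ : ∀ x y → normLap (bipAdj V) (x ↑ˡ q) (p ↑ʳ y) ≈ 0# - normBiadj V x y
    normLap-bipAdj-↑ˡ↑ʳ x y = reflexive (cong₂ _-_ (I-↑ˡ↑ʳ x y)
      (cong₂ _·_ (cong₂ _·_ (cong invSqrt (degree-bipAdj-↑ˡ V x)) (cong ι (bipAdj-↑ˡ↑ʳ V x y)))
                 (cong invSqrt (degree-bipAdj-↑ʳ V y))))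

    normLap-bipAdj-↑ʳ↑ˡ : ∀ y x → normLap (bipAdj V) (p ↑ʳ y) (x ↑ˡ q) ≈ 0# - normBiadj V x y
    normLap-bipAdj-↑ʳ↑ˡ y x = trans
      (reflexive (cong₂ _-_ (I-↑ʳ↑ˡ y x)
        (cong₂ _·_ (cong₂ _·_ (cong invSqrt (degree-bipAdj-↑ʳ V y)) (cong ι (bipAdj-↑ʳ↑ˡ V y x)))
                   (cong invSqrt (degree-bipAdj-↑ˡ V x)))))
      (+-congˡ (-‿cong (xy∙z≈zy∙x _ _ _)))

  twoIminus-diagonal : ∀ {n} (M : Mat Carrier n n) {i j u} →
                       I i j ≈ u → M i j ≈ u → twoIminus M i j ≈ u
  twoIminus-diagonal M {i} {j} {u} Iᵢⱼ≈u Mᵢⱼ≈u = begin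
    (I i j + I i j) - M i j  ≈⟨ +-cong (+-cong Iᵢⱼ≈u Iᵢⱼ≈u) (-‿cong Mᵢⱼ≈u) ⟩
    (u + u) - u              ≈⟨ +-assoc u u (- u) ⟩
    u + (u - u)              ≈⟨ +-congˡ (-‿inverseʳ u) ⟩
    u + 0#                   ≈⟨ +-identityʳ u ⟩
    u                        ∎

  twoIminus-offDiagonal : ∀ {n} (M : Mat Carrier n n) {i j x y} →
                          I i j ≈ 0# → M i j ≈ (0# - x) · (0# - y) → twoIminus M i j ≈ 0# - x · y
  twoIminus-offDiagonal M {i} {j} {x} {y} Iᵢⱼ≈0 Mᵢⱼ≈ = begin
    (I i j + I i j) - M i j          ≈⟨ +-cong (+-cong Iᵢⱼ≈0 Iᵢⱼ≈0) (-‿cong Mᵢⱼ≈) ⟩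
    (0# + 0#) - (0# - x) · (0# - y)  ≈⟨ +-cong (+-identityˡ 0#)
                                                (-‿cong (*-cong (+-identityˡ (- x)) (+-identityˡ (- y)))) ⟩
    0# - (- x) · (- y)               ≈⟨ +-congˡ (-‿cong (-x·-y≈x·y x y)) ⟩
    0# - x · y                       ∎

  module _ {p₁ q₁ p₂ q₂} {V₁ : Mat Bool p₁ q₁} {V₂ : Mat Bool p₂ q₂}
           (noIsolated₁ : NoIsolated V₁) (noIsolated₂ : NoIsolated V₂) where

    normBiadj-kron : ∀ a b a' b' → normBiadj (kron _∧_ V₁ V₂) (combine a b) (combine a' b')
                                   ≈ normBiadj V₁ a a' · normBiadj V₂ b b'
    normBiadj-kron a b a' b' = begin
      normBiadj (kron _∧_ V₁ V₂) (combine a b) (combine a' b')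
        ≡⟨ cong₂ _·_ (cong₂ _·_ (cong invSqrt (rowDeg-kron V₁ V₂ a b))
                                (cong ι (b2n-kron V₁ V₂ a b a' b')))
                     (cong invSqrt (colDeg-kron V₁ V₂ a' b')) ⟩
      invSqrt (r₁ * r₂) · ι (e₁ * e₂) · invSqrt (c₁ * c₂)
        ≈⟨ *-cong (*-cong (invSqrt-* r₁ r₂ {{r₁≢0}} {{r₂≢0}}) (ι-* e₁ e₂))
                  (invSqrt-* c₁ c₂ {{c₁≢0}} {{c₂≢0}}) ⟩
      (invSqrt r₁ · invSqrt r₂) · (ι e₁ · ι e₂) · (invSqrt c₁ · invSqrt c₂)
        ≈⟨ *-congʳ (interchange (invSqrt r₁) (invSqrt r₂) (ι e₁) (ι e₂)) ⟩
      (invSqrt r₁ · ι e₁) · (invSqrt r₂ · ι e₂) · (invSqrt c₁ · invSqrt c₂)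
        ≈⟨ interchange (invSqrt r₁ · ι e₁) (invSqrt r₂ · ι e₂) (invSqrt c₁) (invSqrt c₂) ⟩
      normBiadj V₁ a a' · normBiadj V₂ b b'
        ∎
      where
      r₁ = rowDeg V₁ a;  r₂ = rowDeg V₂ b
      c₁ = colDeg V₁ a'; c₂ = colDeg V₂ b'
      e₁ = b2n (V₁ a a'); e₂ = b2n (V₂ b b')
      r₁≢0 = rowDeg-nonZero V₁ noIsolated₁ a
      r₂≢0 = rowDeg-nonZero V₂ noIsolated₂ b
      c₁≢0 = colDeg-nonZero V₁ noIsolated₁ a'
      c₂≢0 = colDeg-nonZero V₂ noIsolated₂ b'

    normLap-bipAdj-kron :
      normLap (bipAdj (kron _∧_ V₁ V₂))
        ≋ twoIminus (ptensor _·_ p₁ q₁ p₂ q₂ (normLap (bipAdj V₁)) (normLap (bipAdj V₂)))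
    normLap-bipAdj-kron = tensor-ind₂ _ ↑ˡ↑ˡ ↑ˡ↑ʳ ↑ʳ↑ˡ ↑ʳ↑ʳ
      where
      W = kron _∧_ V₁ V₂
      L₁ = normLap (bipAdj V₁)
      L₂ = normLap (bipAdj V₂)
      T = ptensor _·_ p₁ q₁ p₂ q₂ L₁ L₂

      ↑ˡ↑ˡ : ∀ a b a' b' → normLap (bipAdj W) (combine a b ↑ˡ q₁ * q₂) (combine a' b' ↑ˡ q₁ * q₂)
                           ≈ twoIminus T (combine a b ↑ˡ q₁ * q₂) (combine a' b' ↑ˡ q₁ * q₂)
      ↑ˡ↑ˡ a b a' b' = trans (trans (normLap-bipAdj-↑ˡ↑ˡ W _ _) (I-combine a b a' b'))
        (sym (twoIminus-diagonal T
          (trans (reflexive (I-↑ˡ↑ˡ {q = q₁ * q₂} (combine a b) (combine a' b')))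
                 (I-combine a b a' b'))
          (trans (reflexive (ptensor-↑ˡ↑ˡ _·_ L₁ L₂ a b a' b'))
                 (*-cong (normLap-bipAdj-↑ˡ↑ˡ V₁ a a') (normLap-bipAdj-↑ˡ↑ˡ V₂ b b')))))

      ↑ʳ↑ʳ : ∀ a b a' b' → normLap (bipAdj W) (p₁ * p₂ ↑ʳ combine a b) (p₁ * p₂ ↑ʳ combine a' b')
                           ≈ twoIminus T (p₁ * p₂ ↑ʳ combine a b) (p₁ * p₂ ↑ʳ combine a' b')
      ↑ʳ↑ʳ a b a' b' = trans (trans (normLap-bipAdj-↑ʳ↑ʳ W _ _) (I-combine a b a' b'))
        (sym (twoIminus-diagonal T
          (trans (reflexive (I-↑ʳ↑ʳ {p₁ * p₂} (combine a b) (combine a' b')))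
                 (I-combine a b a' b'))
          (trans (reflexive (ptensor-↑ʳ↑ʳ _·_ L₁ L₂ a b a' b'))
                 (*-cong (normLap-bipAdj-↑ʳ↑ʳ V₁ a a') (normLap-bipAdj-↑ʳ↑ʳ V₂ b b')))))

      ↑ˡ↑ʳ : ∀ a b a' b' → normLap (bipAdj W) (combine a b ↑ˡ q₁ * q₂) (p₁ * p₂ ↑ʳ combine a' b')
                           ≈ twoIminus T (combine a b ↑ˡ q₁ * q₂) (p₁ * p₂ ↑ʳ combine a' b')
      ↑ˡ↑ʳ a b a' b' =
        trans (trans (normLap-bipAdj-↑ˡ↑ʳ W _ _) (+-congˡ (-‿cong (normBiadj-kron a b a' b'))))
        (sym (twoIminus-offDiagonal T
          (reflexive (I-↑ˡ↑ʳ (combine a b) (combine a' b')))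
          (trans (reflexive (ptensor-↑ˡ↑ʳ _·_ L₁ L₂ a b a' b'))
                 (*-cong (normLap-bipAdj-↑ˡ↑ʳ V₁ a a') (normLap-bipAdj-↑ˡ↑ʳ V₂ b b')))))

      ↑ʳ↑ˡ : ∀ a b a' b' → normLap (bipAdj W) (p₁ * p₂ ↑ʳ combine a b) (combine a' b' ↑ˡ q₁ * q₂)
                           ≈ twoIminus T (p₁ * p₂ ↑ʳ combine a b) (combine a' b' ↑ˡ q₁ * q₂)
      ↑ʳ↑ˡ a b a' b' =
        trans (trans (normLap-bipAdj-↑ʳ↑ˡ W _ _) (+-congˡ (-‿cong (normBiadj-kron a' b' a b))))
        (sym (twoIminus-offDiagonal T
          (reflexive (I-↑ʳ↑ˡ (combine a b) (combine a' b')))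
          (trans (reflexive (ptensor-↑ʳ↑ˡ _·_ L₁ L₂ a b a' b'))
                 (*-cong (normLap-bipAdj-↑ʳ↑ˡ V₁ a a') (normLap-bipAdj-↑ʳ↑ˡ V₂ b b')))))

lemma3p2 : ∀ {c ℓ₁ ℓ₂ : Level} (F : EuclideanField c ℓ₁ ℓ₂) →
           ∀ {p₁ q₁ p₂ q₂ : ℕ} (V₁ : Mat Bool p₁ q₁) (V₂ : Mat Bool p₂ q₂) →
           NoIsolated V₁ → NoIsolated V₂ →
           let open Spectral F in
           normLap (ptensor _*_ p₁ q₁ p₂ q₂ (bipAdj V₁) (bipAdj V₂))
             ≋ twoIminus (ptensor (EuclideanField._*_ F) p₁ q₁ p₂ q₂
                        (normLap (bipAdj V₁)) (normLap (bipAdj V₂)))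
lemma3p2 F V₁ V₂ noIsolated₁ noIsolated₂ i j =
  trans (reflexive (normLap-cong F (ptensor-bipAdj V₁ V₂) i j))
        (normLap-bipAdj-kron F noIsolated₁ noIsolated₂ i j)
  where open EuclideanField F using (trans; reflexive)
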